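{- Let $\Sigma$ be an ordered alphabet. If $w\in\Sigma^n$ is self-minimal and $d\mid n$, then $\mathcal{C}_d(w)=\mathcal{C}(w_{(d)})$.
   Context: $\langle x\rangle$ is the lexicographically minimal cyclic rotation of $x$; $w$ is self-minimal if $\langle w\rangle=w$. $w_{(d)}$ is the length-$d$ prefix of $w$. For a word $v$, $\mathcal{C}(v)=\{x\in\Sigma^{|v|}:\langle x\rangle\le v\}$, and for $d\mid n$, $\mathcal{C}_d(w)=\{x\in\Sigma^d:\langle x\rangle^{n/d}\le w\}$, where $u^k$ is the concatenation of $k$ copies of $u$. -}

module Defs where

open import Level using (Level)
open import Data.Nat using (ℕ; zero; suc; _*_; _∸_)
open import Data.Vec using (Vec; []; _∷_; _∷ʳ_; _++_; take)
open import Data.Sum using (_⊎_)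
open import Data.Product using (_×_)
open import Relation.Binary.Core using (Rel)
open import Relation.Binary.Structures using (IsStrictTotalOrder)
open import Relation.Binary.Definitions using (tri<; tri≈; tri>)
open import Relation.Binary.PropositionalEquality using (_≡_)
open import Data.Bool using (Bool; true; false; if_then_else_)

module Words {a ℓ : Level} {Σ : Set a} {_<_ : Rel Σ ℓ}
             (sto : IsStrictTotalOrder _≡_ _<_) where

  open IsStrictTotalOrder sto using (compare)

  data _≤ₗ_ : {n : ℕ} → Vec Σ n → Vec Σ n → Set (a Level.⊔ ℓ) where
    []≤  : [] ≤ₗ []
    here : ∀ {n x y} {xs ys : Vec Σ n} → x < y → (x ∷ xs) ≤ₗ (y ∷ ys)
    next : ∀ {n x y} {xs ys : Vec Σ n} → x ≡ y → xs ≤ₗ ys → (x ∷ xs) ≤ₗ (y ∷ ys)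

  leqᵇ : {n : ℕ} → Vec Σ n → Vec Σ n → Bool
  leqᵇ [] [] = true
  leqᵇ (x ∷ xs) (y ∷ ys) with compare x y
  ... | tri< _ _ _ = true
  ... | tri≈ _ _ _ = leqᵇ xs ys
  ... | tri> _ _ _ = false

  lexMin : {n : ℕ} → Vec Σ n → Vec Σ n → Vec Σ n
  lexMin u v = if leqᵇ u v then u else v

  rot : {n : ℕ} → Vec Σ n → Vec Σ n
  rot [] = []
  rot (x ∷ xs) = xs ∷ʳ x

  minRot : {n : ℕ} → ℕ → Vec Σ n → Vec Σ n
  minRot zero x = x
  minRot (suc k) x = lexMin x (minRot k (rot x))

  ⟨_⟩ : {n : ℕ} → Vec Σ n → Vec Σ n
  ⟨_⟩ {n} x = minRot (n ∸ 1) x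

  SelfMinimal : {n : ℕ} → Vec Σ n → Set a
  SelfMinimal w = ⟨ w ⟩ ≡ w

  _^_ : {d : ℕ} → Vec Σ d → (k : ℕ) → Vec Σ (k * d)
  u ^ zero = []
  u ^ suc k = u ++ (u ^ k)

  𝒞 : {m : ℕ} → Vec Σ m → Vec Σ m → Set (a Level.⊔ ℓ)
  𝒞 v x = ⟨ x ⟩ ≤ₗ v

  -- 𝒞_d(w) for |w| = n = k * d (k = n/d): { x ∈ Σ^d : ⟨x⟩^(n/d) ≤ w }
  𝒞[_] : (d : ℕ) {k : ℕ} → Vec Σ (k * d) → Vec Σ d → Set (a Level.⊔ ℓ)
  𝒞[ d ] {k} w x = (⟨ x ⟩ ^ k) ≤ₗ w

module Submission where

-- Let w be a self-minimal word of length n = k·d (k ≥ 1) with length-d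
-- prefix Y = w_(d).  We prove  y^k ≤ w ⟺ y ≤ Y  for EVERY word y of length d;
-- the theorem is the instance y = ⟨x⟩.
--   (⇒) In y^k = y·y^(k-1) versus w = Y·w′ the first d letters decide: y ≤ Y.
--   (⇐) Self-minimality says w ≤ each cyclic rotation of w.  Comparing w with
--       the rotation starting at position i·d shows Y ≤ (i-th length-d block
--       of w), so y ≤ Y ≤ block i for each i; concatenating gives y^k ≤ w.
-- Words are compared with the library's lexicographic order on vectors,
-- which relates vectors whose lengths are merely propositionally equal, so a
-- rotation Z·P of P·Z is compared with P·Z without casts.

open import Defs
open import Level using (Level; _⊔_)
open import Data.Nat using (ℕ; suc; _*_)
open import Data.Vec using (Vec; take)
open import Relation.Binary.Core using (Rel)
open import Relation.Binary.Structures using (IsStrictTotalOrder)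
open import Relation.Binary.PropositionalEquality using (_≡_)
open import Function.Bundles using (_⇔_)

open import Data.Nat using (zero; _+_; _∸_; _≤_; s≤s)
open import Data.Nat.Properties using (+-suc; m≤m+n)
open import Data.Bool using (true; false)
open import Data.Product using (_,_)
open import Data.Unit using (tt)
open import Data.Vec using ([]; _∷_; _∷ʳ_; _++_; drop; splitAt)
open import Data.Vec.Properties using (take++drop≡id)
open import Data.Vec.Relation.Binary.Lex.Core using (base; this; next)
  renaming (length-equal to ≼-length)
import Data.Vec.Relation.Binary.Lex.Strict as Lex
open import Relation.Binary.Definitions using (tri<; tri≈; tri>)
open import Relation.Binary.PropositionalEquality using (refl; sym; cong₂; subst)
open import Function.Bundles using (mk⇔)

module SelfMinimalWords {a ℓ : Level} {Σ : Set a} {_<_ : Rel Σ ℓ}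
                        (sto : IsStrictTotalOrder _≡_ _<_) where

  open Words sto
  open import Data.Vec.Relation.Binary.Equality.Propositional {A = Σ}
    using (_≋_; []; _∷_; ≋-refl; ≋-sym; ≋-trans; ≡⇒≋; ++-assoc; ++-identityʳ)
    renaming (length-equal to ≋-length)
  open IsStrictTotalOrder sto
    using (compare; module Eq; <-resp-≈) renaming (trans to <-trans)

  infix 4 _≼_
  _≼_ : ∀ {m n} → Vec Σ m → Vec Σ n → Set (a ⊔ ℓ)
  _≼_ = Lex.Lex-≤ _≡_ _<_

  ≼-refl : ∀ {m n} {u : Vec Σ m} {v : Vec Σ n} → u ≋ v → u ≼ v
  ≼-refl = Lex.≤-refl

  ≼-trans : ∀ {m n o} {u : Vec Σ m} {v : Vec Σ n} {x : Vec Σ o} →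
            u ≼ v → v ≼ x → u ≼ x
  ≼-trans = Lex.≤-trans Eq.isPartialEquivalence <-resp-≈ <-trans

  ≋-≼-trans : ∀ {m n o} {u : Vec Σ m} {v : Vec Σ n} {x : Vec Σ o} →
              u ≋ v → v ≼ x → u ≼ x
  ≋-≼-trans u≋v = ≼-trans (≼-refl u≋v)

  ≼-≋-trans : ∀ {m n o} {u : Vec Σ m} {v : Vec Σ n} {x : Vec Σ o} →
              u ≼ v → v ≋ x → u ≼ x
  ≼-≋-trans u≼v v≋x = ≼-trans u≼v (≼-refl v≋x)

  ≤ₗ⇒≼ : ∀ {n} {u v : Vec Σ n} → u ≤ₗ v → u ≼ v
  ≤ₗ⇒≼ []≤          = base tt
  ≤ₗ⇒≼ (here x<y)   = this x<y refl
  ≤ₗ⇒≼ (next x≡y p) = next x≡y (≤ₗ⇒≼ p)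

  ≼⇒≤ₗ : ∀ {n} {u v : Vec Σ n} → u ≼ v → u ≤ₗ v
  ≼⇒≤ₗ {u = []}    {[]}    (base _)      = []≤
  ≼⇒≤ₗ {u = _ ∷ _} {_ ∷ _} (this x<y _)  = here x<y
  ≼⇒≤ₗ {u = _ ∷ _} {_ ∷ _} (next x≡y p)  = next x≡y (≼⇒≤ₗ p)

  ≼-++ : ∀ {m m′ n n′} {u : Vec Σ m} {u′ : Vec Σ m′} {v : Vec Σ n} {v′ : Vec Σ n′} →
         u ≼ u′ → v ≼ v′ → u ++ v ≼ u′ ++ v′
  ≼-++ (base _)     v≼v′ = v≼v′
  ≼-++ (this x<y e) v≼v′ = this x<y (cong₂ _+_ e (≼-length v≼v′))
  ≼-++ (next x≡y p) v≼v′ = next x≡y (≼-++ p v≼v′)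

  ≼-prefix : ∀ {m n n′} (u u′ : Vec Σ m) {v : Vec Σ n} {v′ : Vec Σ n′} →
             u ++ v ≼ u′ ++ v′ → u ≼ u′
  ≼-prefix []      []       _            = base tt
  ≼-prefix (_ ∷ u) (_ ∷ u′) (this x<y _) = this x<y refl
  ≼-prefix (_ ∷ u) (_ ∷ u′) (next x≡y p) = next x≡y (≼-prefix u u′ p)

  leqᵇ-true : ∀ {n} (u v : Vec Σ n) → leqᵇ u v ≡ true → u ≼ v
  leqᵇ-true []       []       _ = base tt
  leqᵇ-true (x ∷ u) (y ∷ v) eq with compare x y
  ... | tri< x<y _ _ = this x<y refl
  ... | tri≈ _ x≡y _ = next x≡y (leqᵇ-true u v eq)

  leqᵇ-false : ∀ {n} (u v : Vec Σ n) → leqᵇ u v ≡ false → v ≼ u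
  leqᵇ-false []      []      ()
  leqᵇ-false (x ∷ u) (y ∷ v) eq with compare x y
  ... | tri≈ _ x≡y _ = next (sym x≡y) (leqᵇ-false u v eq)
  ... | tri> _ _ y<x = this y<x refl

  lexMin-≼ˡ : ∀ {n} (u v : Vec Σ n) → lexMin u v ≼ u
  lexMin-≼ˡ u v with leqᵇ u v in eq
  ... | true  = ≼-refl ≋-refl
  ... | false = leqᵇ-false u v eq

  lexMin-≼ʳ : ∀ {n} (u v : Vec Σ n) → lexMin u v ≼ v
  lexMin-≼ʳ u v with leqᵇ u v in eq
  ... | true  = leqᵇ-true u v eq
  ... | false = ≼-refl ≋-refl

  rotate : ∀ {n} → ℕ → Vec Σ n → Vec Σ n
  rotate zero    x = x
  rotate (suc j) x = rotate j (rot x)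

  minRot-≼-rotate : ∀ {n} k j (x : Vec Σ n) → j ≤ k → minRot k x ≼ rotate j x
  minRot-≼-rotate zero    zero    x _         = ≼-refl ≋-refl
  minRot-≼-rotate (suc k) zero    x _         = lexMin-≼ˡ x _
  minRot-≼-rotate (suc k) (suc j) x (s≤s j≤k) =
    ≼-trans (lexMin-≼ʳ x _) (minRot-≼-rotate k j (rot x) j≤k)

  ∷ʳ-≋ : ∀ {m n} {u : Vec Σ m} {v : Vec Σ n} {x y : Σ} →
         u ≋ v → x ≡ y → u ∷ʳ x ≋ v ∷ʳ y
  ∷ʳ-≋ []         x≡y = x≡y ∷ []
  ∷ʳ-≋ (e ∷ u≋v) x≡y = e ∷ ∷ʳ-≋ u≋v x≡y

  rotate-≋ : ∀ {m n} j {u : Vec Σ m} {v : Vec Σ n} → u ≋ v → rotate j u ≋ rotate j v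
  rotate-≋ zero    u≋v       = u≋v
  rotate-≋ (suc j) []        = rotate-≋ j []
  rotate-≋ (suc j) (e ∷ u≋v) = rotate-≋ j (∷ʳ-≋ u≋v e)

  ++-∷ʳ : ∀ {p m} (P : Vec Σ p) (Z : Vec Σ m) (x : Σ) → (P ++ Z) ∷ʳ x ≋ P ++ (Z ∷ʳ x)
  ++-∷ʳ []      Z x = ≋-refl
  ++-∷ʳ (y ∷ P) Z x = refl ∷ ++-∷ʳ P Z x

  ∷ʳ-++ : ∀ {m p} (Z : Vec Σ m) (x : Σ) (P : Vec Σ p) → (Z ∷ʳ x) ++ P ≋ Z ++ (x ∷ P)
  ∷ʳ-++ []      x P = ≋-refl
  ∷ʳ-++ (y ∷ Z) x P = refl ∷ ∷ʳ-++ Z x P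

  rotate-++ : ∀ {p m} (P : Vec Σ p) (Z : Vec Σ m) → rotate p (P ++ Z) ≋ Z ++ P
  rotate-++ []      Z = ≋-sym (++-identityʳ Z)
  rotate-++ {suc p} (x ∷ P) Z =
    ≋-trans (rotate-≋ p (++-∷ʳ P Z x))
            (≋-trans (rotate-++ P (Z ∷ʳ x)) (∷ʳ-++ Z x P))

  selfMinimal-≼-rotation : ∀ {n p m} {w : Vec Σ n} → SelfMinimal w →
    (P : Vec Σ p) (Z : Vec Σ m) → w ≋ P ++ Z → w ≼ Z ++ P
  selfMinimal-≼-rotation sm P [] w≋PZ = ≼-refl (≋-trans w≋PZ (++-identityʳ P))
  selfMinimal-≼-rotation {n} {p} {suc m} {w} sm P Z@(_ ∷ _) w≋PZ =
    subst (_≼ Z ++ P) sm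
      (≼-≋-trans (minRot-≼-rotate (n ∸ 1) p w p≤n-1)
                 (≋-trans (rotate-≋ p w≋PZ) (rotate-++ P Z)))
    where
    p≤n-1 : p ≤ n ∸ 1
    p≤n-1 = subst (λ k → p ≤ k ∸ 1) (sym (≋-length w≋PZ))
              (subst (λ k → p ≤ k ∸ 1) (sym (+-suc p m)) (m≤m+n p m))

  prefix-≼-factor : ∀ {n d r p m} {w : Vec Σ n} → SelfMinimal w →
    (Y : Vec Σ d) {R : Vec Σ r} → w ≋ Y ++ R →
    (P : Vec Σ p) (A : Vec Σ d) (Z : Vec Σ m) → w ≋ P ++ (A ++ Z) → Y ≼ A
  prefix-≼-factor sm Y w≋YR P A Z w≋PAZ =
    ≼-prefix Y A
      (≋-≼-trans (≋-sym w≋YR)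
        (≼-≋-trans (selfMinimal-≼-rotation sm P (A ++ Z) w≋PAZ) (++-assoc A Z P)))

  power-≼-suffix : ∀ {n d r} {w : Vec Σ n} → SelfMinimal w →
    (Y : Vec Σ d) {R : Vec Σ r} → w ≋ Y ++ R → (y : Vec Σ d) → y ≼ Y →
    ∀ j {p} (P : Vec Σ p) (Z : Vec Σ (j * d)) → w ≋ P ++ Z → y ^ j ≼ Z
  power-≼-suffix sm Y w≋YR y y≼Y zero    P []  _     = base tt
  power-≼-suffix {d = d} sm Y w≋YR y y≼Y (suc j) P Z w≋PZ
    with splitAt d Z
  ... | A , Z′ , refl =
    ≼-++ (≼-trans y≼Y (prefix-≼-factor sm Y w≋YR P A Z′ w≋PZ))
         (power-≼-suffix sm Y w≋YR y y≼Y j (P ++ A) Z′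
            (≋-trans w≋PZ (≋-sym (++-assoc P A Z′))))

  power-≤-selfMinimal⇔ : (q d : ℕ) (w : Vec Σ (suc q * d)) → SelfMinimal w →
    (y : Vec Σ d) → (y ^ suc q) ≤ₗ w ⇔ y ≤ₗ take d w
  power-≤-selfMinimal⇔ q d w sm y = mk⇔ power⇒prefix prefix⇒power
    where
    w≋Y++R : w ≋ take d w ++ drop d w
    w≋Y++R = ≡⇒≋ (sym (take++drop≡id d w))

    power⇒prefix : (y ^ suc q) ≤ₗ w → y ≤ₗ take d w
    power⇒prefix yᵏ≤w = ≼⇒≤ₗ (≼-prefix y (take d w) (≼-≋-trans (≤ₗ⇒≼ yᵏ≤w) w≋Y++R))

    prefix⇒power : y ≤ₗ take d w → (y ^ suc q) ≤ₗ w
    prefix⇒power y≤Y =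
      ≼⇒≤ₗ (power-≼-suffix sm (take d w) w≋Y++R y (≤ₗ⇒≼ y≤Y) (suc q) [] w ≋-refl)

mainTheorem18 : ∀ {a ℓ : Level} {Σ : Set a} {_<_ : Rel Σ ℓ}
    (sto : IsStrictTotalOrder _≡_ _<_) →
    let open Words sto in
    (q d : ℕ) (w : Vec Σ (suc q * d)) →
    SelfMinimal w →
    (x : Vec Σ d) → 𝒞[ d ] {suc q} w x ⇔ 𝒞 (take d w) x
mainTheorem18 sto q d w sm x = power-≤-selfMinimal⇔ q d w sm ⟨ x ⟩
  where open Words sto
        open SelfMinimalWords sto
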